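{- Let $\Gamma$ be a bipartite graph with bipartition $V(\Gamma)=V_0\sqcup V_1$, so that every edge joins a vertex of $V_0$ to a vertex of $V_1$. In $C^0(\Gamma)=\bigotimes_{v\in V(\Gamma)}\mathcal{C}$ define: - $S_0$ as the element where each vertex of $V_0$ carries $a_0$ and each vertex of $V_1$ carries $a_1$; - $S_1$ as the element where each vertex of $V_0$ carries $a_1$ and each vertex of $V_1$ carries $a_0$. Here $a_0=\tfrac12(x+1)$ and $a_1=\tfrac12(x-1)$. Then $(\Phi+d)(S_0)=(\Phi+d)(S_1)=0$, i.e. $S_0$ and $S_1$ are cocycles in $(C^0(\Gamma),\Phi+d)$.
   Context: Let $\Gamma$ be a finite graph with totally ordered edges. States. A state is a spanning subgraph $s$ of $\Gamma$. Its dimension is its number of edges. An enhanced state labels each connected component of $s$ by $1$ or $x$. Cochain groups. $C^i(\Gamma)$ is the $\mathbb{Q}$-vector space with basis the enhanced states of dimension $i$. The span of the enhanced states with a given underlying state $s$ is identified with $\mathcal{C}^{\otimes(\text{components of }s)}$, where $\mathcal{C}$ is the $2$-dimensional vector space with basis $1,x$. In particular $C^0(\Gamma)=\bigotimes_{v\in V(\Gamma)}\mathcal{C}$. The operator $\Phi+d$. For an enhanced state $S$ with state $s$, let $n(s,e)$ be the number of edges of $s$ smaller than $e$, and set $(\Phi+d)(S)=\sum_{e\notin s}(-1)^{n(s,e)}T_e$. Here: - if both endpoints of $e$ lie in one component of $s$, then $T_e$ is the enhanced state on $s\cup\{e\}$ with the same labels; - if $e$ joins distinct components labelled $a,b$,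 then the merged component is labelled by the product $ab$ in the algebra $\mathcal{C}=\mathbb{Q}[x]/(x^2-1)$ (so $1\cdot1=1$, $1\cdot x=x\cdot 1=x$, $x\cdot x=1$), extended multilinearly. This operator equals $\Phi+d$, where: - $d$ is the analogous operator with multiplication in $\mathbb{Q}[x]/(x^2)$ ($x\cdot x=0$); - $\Phi$ is the analogous operator that only counts merging edges and uses $x\cdot x=1$, $1\cdot 1=1\cdot x=x\cdot 1=0$. -}

module Defs where

open import Data.Nat using (ℕ; zero; suc)
open import Data.Fin using (Fin; zero; suc; _≟_)
open import Data.Bool using (Bool; true; false; if_then_else_; _xor_)
open import Data.Product using (_×_; _,_; proj₁; proj₂)
open import Data.Rational using (ℚ; 0ℚ; 1ℚ; ½; -_; _+_; _*_)
open import Relation.Nullary.Decidable using (⌊_⌋; yes; no)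
open import Relation.Binary.PropositionalEquality using (_≡_)

-- A finite graph with n vertices (Fin n) and m edges (Fin m); edge e has
-- endpoints E e.  The total order on edges is the order of Fin m.
Graph : ℕ → ℕ → Set
Graph n m = Fin m → Fin n × Fin n

-- Basis of 𝒞 = ℚ[x]/(x²-1): false ↔ 1, true ↔ x.
-- Multiplication of basis elements is xor (1·1=1, 1·x=x·1=x, x·x=1).
Label : Set
Label = Bool

𝒞 : Set
𝒞 = Label → ℚ

a₀ : 𝒞
a₀ false = ½
a₀ true  = ½

a₁ : 𝒞
a₁ false = - ½
a₁ true  = ½

∏ : (n : ℕ) → (Fin n → ℚ) → ℚ
∏ zero    f = 1ℚ
∏ (suc n) f = f zero * ∏ n (λ i → f (suc i))

-- C⁰(Γ) = ⊗_{v} 𝒞 : the only dimension-0 state is the edgeless spanning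
-- subgraph, whose components are the single vertices; an enhanced state is a
-- labelling of vertices, and a cochain is its coefficient function.
C⁰ : ℕ → Set
C⁰ n = (Fin n → Label) → ℚ

pureTensor : (n : ℕ) → (Fin n → 𝒞) → C⁰ n
pureTensor n f ℓ = ∏ n (λ v → f v (ℓ v))

-- C¹(Γ): enhanced states of dimension 1 are an edge e together with a labelling
-- of the components of the spanning subgraph {e}.  We encode such a labelling
-- as a vertex labelling ℓ constant on components, i.e. ℓ (src e) ≡ ℓ (tgt e).
C¹ : ℕ → ℕ → Set
C¹ n m = Fin m → (Fin n → Label) → ℚ

ValidC¹ : {n m : ℕ} → Graph n m → Fin m → (Fin n → Label) → Set
ValidC¹ E e ℓ = ℓ (proj₁ (E e)) ≡ ℓ (proj₂ (E e))

IsZeroC¹ : {n m : ℕ} → Graph n m → C¹ n m → Set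
IsZeroC¹ E y = ∀ e ℓ → ValidC¹ E e ℓ → y e ℓ ≡ 0ℚ

update : {n : ℕ} → (Fin n → Label) → Fin n → Label → (Fin n → Label)
update ℓ w b z = if ⌊ z ≟ w ⌋ then b else ℓ z

-- For S of dimension 0, n(∅,e) = 0 so all signs are +1, and
-- each edge e gives the term T_e on the distinct state {e}.
--  * loop e at u (endpoints in one component): T_e has the same labels;
--  * e joining u ≠ v: the merged component gets the product ℓ u · ℓ v in
--    ℚ[x]/(x²-1).  Extended linearly, the coefficient of the enhanced state
--    with merged label t = ℓ u is Σ_{a·b = t} c(ℓ[u:=a, v:=b]), b = a xor t.
ΦplusD : {n m : ℕ} → Graph n m → C⁰ n → C¹ n m
ΦplusD E c e ℓ with proj₁ (E e) ≟ proj₂ (E e)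
... | yes _ = c ℓ
... | no  _ =
  let u = proj₁ (E e) ; v = proj₂ (E e) ; t = ℓ u in
  c (update (update ℓ u false) v (false xor t))
  + c (update (update ℓ u true) v (true xor t))

-- Bipartition: side v = false means v ∈ V₀, side v = true means v ∈ V₁.
IsBipartition : {n m : ℕ} → Graph n m → (Fin n → Bool) → Set
IsBipartition E side = ∀ e → side (proj₁ (E e)) ≡ side (proj₂ (E e)) → Data.Empty.⊥
  where import Data.Empty

S₀ : {n : ℕ} → (Fin n → Bool) → C⁰ n
S₀ {n} side = pureTensor n (λ v → if side v then a₁ else a₀)

S₁ : {n : ℕ} → (Fin n → Bool) → C⁰ n
S₁ {n} side = pureTensor n (λ v → if side v then a₀ else a₁)

-- In 𝒞 = ℚ[x]/(x²-1) one has a₀a₁ = ¼(x²-1) = 0.  On a pure tensor ⊗_w F w,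
-- the coefficient of (Φ+d) along an edge e = uv (u ≠ v) is the product
-- F u · F v in 𝒞, evaluated at the merged label, times the factors of the
-- remaining vertices.  In a bipartite graph there are no loops and the two
-- endpoints of every edge carry a₀ and a₁ in some order, so every coefficient
-- of (Φ+d)(S₀) and (Φ+d)(S₁) contains the factor a₀a₁ = 0.
module Submission where

open import Defs
open import Data.Nat using (ℕ; zero; suc)
open import Data.Fin using (Fin; zero; suc; _≟_)
open import Data.Bool using (Bool; true; false; if_then_else_; _xor_)
open import Data.Product using (_×_; _,_; proj₁; proj₂)
open import Data.Rational using (ℚ; 0ℚ; 1ℚ; _+_; _*_)
open import Data.Rational.Properties
  using (+-comm; *-comm; *-assoc; *-identityˡ; *-zeroˡ; *-distribʳ-+)
open import Relation.Nullary.Decidable using (⌊_⌋; yes; no)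
open import Relation.Nullary.Negation using (contradiction)
open import Relation.Binary.PropositionalEquality
open ≡-Reasoning

infixl 7 _·_

-- The multiplication of ℚ[x]/(x²-1) on coefficient functions, written as in ΦplusD.
_·_ : 𝒞 → 𝒞 → 𝒞
(f · g) t = f false * g (false xor t) + f true * g (true xor t)

·-comm : ∀ f g t → (f · g) t ≡ (g · f) t
·-comm f g false = cong₂ _+_ (*-comm (f false) (g false)) (*-comm (f true) (g true))
·-comm f g true  = trans (+-comm (f false * g true) (f true * g false))
                         (cong₂ _+_ (*-comm (f true) (g false)) (*-comm (f false) (g true)))

a₀·a₁≡0 : ∀ t → (a₀ · a₁) t ≡ 0ℚ
a₀·a₁≡0 false = refl
a₀·a₁≡0 true  = refl

module _ {A : Set} {n : ℕ} where

  -- `update` of Defs is definitionally this operation at A = Label.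
  _[_]≔_ : (Fin n → A) → Fin n → A → Fin n → A
  (h [ u ]≔ a) w = if ⌊ w ≟ u ⌋ then a else h w

  ≔-same : ∀ (h : Fin n → A) u a → (h [ u ]≔ a) u ≡ a
  ≔-same h u a with u ≟ u
  ... | yes _   = refl
  ... | no u≢u = contradiction refl u≢u

  ≔-other : ∀ (h : Fin n → A) {u w} a → w ≢ u → (h [ u ]≔ a) w ≡ h w
  ≔-other h {u} {w} a w≢u with w ≟ u
  ... | yes w≡u = contradiction w≡u w≢u
  ... | no _    = refl

  ≔-≔-cong : ∀ {g h : Fin n → A} {u v} a b →
             (∀ w → w ≢ u → w ≢ v → g w ≡ h w) →
             ∀ w → ((g [ u ]≔ a) [ v ]≔ b) w ≡ ((h [ u ]≔ a) [ v ]≔ b) w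
  ≔-≔-cong {u = u} {v} a b g≗h w with w ≟ v | w ≟ u
  ... | yes _ | _     = refl
  ... | no _  | yes _ = refl
  ... | no w≢v | no w≢u = g≗h w w≢u w≢v

≔-suc : ∀ {A : Set} {n} (h : Fin (suc n) → A) u a i →
        ((λ j → h (suc j)) [ u ]≔ a) i ≡ (h [ suc u ]≔ a) (suc i)
≔-suc h u a i with i ≟ u
... | yes _ = refl
... | no _  = refl

∏-cong : ∀ n {g h : Fin n → ℚ} → (∀ i → g i ≡ h i) → ∏ n g ≡ ∏ n h
∏-cong zero    g≗h = refl
∏-cong (suc n) g≗h = cong₂ _*_ (g≗h zero) (∏-cong n (λ i → g≗h (suc i)))

∏-extract : ∀ n (h : Fin n → ℚ) u → ∏ n h ≡ h u * ∏ n (h [ u ]≔ 1ℚ)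
∏-extract (suc n) h zero = cong (h zero *_) (sym (*-identityˡ _))
∏-extract (suc n) h (suc u) = begin
  h zero * ∏ n (λ i → h (suc i))
    ≡⟨ cong (h zero *_) (∏-extract n (λ i → h (suc i)) u) ⟩
  h zero * (h (suc u) * r)
    ≡⟨ sym (*-assoc (h zero) (h (suc u)) r) ⟩
  h zero * h (suc u) * r
    ≡⟨ cong (_* r) (*-comm (h zero) (h (suc u))) ⟩
  h (suc u) * h zero * r
    ≡⟨ *-assoc (h (suc u)) (h zero) r ⟩
  h (suc u) * (h zero * r)
    ≡⟨ cong (λ r′ → h (suc u) * (h zero * r′)) (∏-cong n (≔-suc h u 1ℚ)) ⟩
  h (suc u) * ∏ (suc n) (h [ suc u ]≔ 1ℚ) ∎
  where r = ∏ n ((λ i → h (suc i)) [ u ]≔ 1ℚ)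

∏-extract₂ : ∀ n (h : Fin n → ℚ) {u v} → u ≢ v →
             ∏ n h ≡ h u * (h v * ∏ n ((h [ u ]≔ 1ℚ) [ v ]≔ 1ℚ))
∏-extract₂ n h {u} {v} u≢v = begin
  ∏ n h
    ≡⟨ ∏-extract n h u ⟩
  h u * ∏ n (h [ u ]≔ 1ℚ)
    ≡⟨ cong (h u *_) (∏-extract n (h [ u ]≔ 1ℚ) v) ⟩
  h u * ((h [ u ]≔ 1ℚ) v * r)
    ≡⟨ cong (λ c → h u * (c * r)) (≔-other h 1ℚ (λ v≡u → u≢v (sym v≡u))) ⟩
  h u * (h v * r) ∎
  where r = ∏ n ((h [ u ]≔ 1ℚ) [ v ]≔ 1ℚ)

module _ {n : ℕ} (F : Fin n → 𝒞) (ℓ : Fin n → Label) {u v : Fin n} (u≢v : u ≢ v) where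

  private
    weights : (Fin n → Label) → Fin n → ℚ
    weights ℓ′ w = F w (ℓ′ w)

  otherFactors : ℚ
  otherFactors = ∏ n ((weights ℓ [ u ]≔ 1ℚ) [ v ]≔ 1ℚ)

  pureTensor-≔₂ : ∀ a b →
    pureTensor n F ((ℓ [ u ]≔ a) [ v ]≔ b) ≡ F u a * (F v b * otherFactors)
  pureTensor-≔₂ a b = begin
    ∏ n (weights ℓ′)
      ≡⟨ ∏-extract₂ n (weights ℓ′) u≢v ⟩
    F u (ℓ′ u) * (F v (ℓ′ v) * r′)
      ≡⟨ cong₂ (λ a′ b′ → F u a′ * (F v b′ * r′)) ℓ′u≡a (≔-same (ℓ [ u ]≔ a) v b) ⟩
    F u a * (F v b * r′)
      ≡⟨ cong (λ r → F u a * (F v b * r)) (∏-cong n (≔-≔-cong 1ℚ 1ℚ ℓ′≗ℓ)) ⟩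
    F u a * (F v b * otherFactors) ∎
    where
    ℓ′ = (ℓ [ u ]≔ a) [ v ]≔ b
    r′ = ∏ n ((weights ℓ′ [ u ]≔ 1ℚ) [ v ]≔ 1ℚ)

    ℓ′u≡a : ℓ′ u ≡ a
    ℓ′u≡a = trans (≔-other (ℓ [ u ]≔ a) b u≢v) (≔-same ℓ u a)

    ℓ′≗ℓ : ∀ w → w ≢ u → w ≢ v → weights ℓ′ w ≡ weights ℓ w
    ℓ′≗ℓ w w≢u w≢v =
      cong (F w) (trans (≔-other (ℓ [ u ]≔ a) b w≢v) (≔-other ℓ a w≢u))

  pureTensor-merge : ∀ t →
    pureTensor n F ((ℓ [ u ]≔ false) [ v ]≔ (false xor t))
      + pureTensor n F ((ℓ [ u ]≔ true) [ v ]≔ (true xor t))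
    ≡ (F u · F v) t * otherFactors
  pureTensor-merge t = begin
    _ ≡⟨ cong₂ _+_ (pureTensor-≔₂ false (false xor t)) (pureTensor-≔₂ true (true xor t)) ⟩
    F u false * (F v (false xor t) * r) + F u true * (F v (true xor t) * r)
      ≡⟨ cong₂ _+_ (sym (*-assoc (F u false) (F v (false xor t)) r))
                   (sym (*-assoc (F u true) (F v (true xor t)) r)) ⟩
    F u false * F v (false xor t) * r + F u true * F v (true xor t) * r
      ≡⟨ sym (*-distribʳ-+ r (F u false * F v (false xor t)) (F u true * F v (true xor t))) ⟩
    (F u · F v) t * r ∎
    where r = otherFactors

ΦplusD-pureTensor-vanishes : ∀ {n m} (E : Graph n m) (F : Fin n → 𝒞) →
  (∀ e → proj₁ (E e) ≢ proj₂ (E e)) →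
  (∀ e t → (F (proj₁ (E e)) · F (proj₂ (E e))) t ≡ 0ℚ) →
  ∀ e ℓ → ΦplusD E (pureTensor n F) e ℓ ≡ 0ℚ
ΦplusD-pureTensor-vanishes E F loopless annihilates e ℓ
  with proj₁ (E e) ≟ proj₂ (E e)
... | yes u≡v = contradiction u≡v (loopless e)
... | no u≢v = begin
  _ ≡⟨ pureTensor-merge F ℓ u≢v t ⟩
  (F u · F v) t * r ≡⟨ cong (_* r) (annihilates e t) ⟩
  0ℚ * r            ≡⟨ *-zeroˡ r ⟩
  0ℚ ∎
  where
  u = proj₁ (E e)
  v = proj₂ (E e)
  t = ℓ u
  r = otherFactors F ℓ u≢v

colouring : {n : ℕ} → (Fin n → Bool) → 𝒞 → 𝒞 → Fin n → 𝒞
colouring side p q v = if side v then q else p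

module Bipartite {n m : ℕ} (E : Graph n m) (side : Fin n → Bool) (bip : IsBipartition E side) where

  bipartite-loopless : ∀ e → proj₁ (E e) ≢ proj₂ (E e)
  bipartite-loopless e u≡v = bip e (cong side u≡v)

  bipartite-colouring-annihilates : ∀ {p q} → (∀ t → (p · q) t ≡ 0ℚ) →
    ∀ e t → (colouring side p q (proj₁ (E e)) · colouring side p q (proj₂ (E e))) t ≡ 0ℚ
  bipartite-colouring-annihilates {p} {q} pq e t
    with side (proj₁ (E e)) in su | side (proj₂ (E e)) in sv
  ... | false | false = contradiction (trans su (sym sv)) (bip e)
  ... | true  | true  = contradiction (trans su (sym sv)) (bip e)
  ... | false | true  = pq t
  ... | true  | false = trans (·-comm q p t) (pq t)

mainTheorem3 : (n m : ℕ) (E : Graph n m) (side : Fin n → Bool) →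
    IsBipartition E side →
    IsZeroC¹ E (ΦplusD E (S₀ side)) × IsZeroC¹ E (ΦplusD E (S₁ side))
mainTheorem3 n m E side bip =
  cocycle a₀·a₁≡0 , cocycle (λ t → trans (·-comm a₁ a₀ t) (a₀·a₁≡0 t))
  where
  open Bipartite E side bip

  cocycle : ∀ {p q} → (∀ t → (p · q) t ≡ 0ℚ) →
            IsZeroC¹ E (ΦplusD E (pureTensor n (colouring side p q)))
  cocycle {p} {q} pq e ℓ _ =
    ΦplusD-pureTensor-vanishes E (colouring side p q) bipartite-loopless
      (bipartite-colouring-annihilates pq) e ℓ
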